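{- Let $k$ and $n$ be positive integers with $k$ odd. If the path $P_k$ divides the hypercube $Q_n$, then $k$ divides $n$.
   Context: $Q_n$ is the $n$-dimensional hypercube: vertex set the subsets of $\{1,\ldots,n\}$, with $x,y$ adjacent iff $|x\,\Delta\, y|=1$. $P_k$ denotes the path with $k$ edges. If $H$ is isomorphic to a subgraph of $G$, $H$ divides $G$ if there exist embeddings $\theta_1,\ldots,\theta_r$ of $H$ into $G$ such that $\{E(\theta_1(H)),\ldots,E(\theta_r(H))\}$ is a partition of $E(G)$. -}

module Defs where

open import Data.Nat using (ℕ; suc; _+_; _*_)
open import Data.Fin using (Fin; inject₁) renaming (suc to fsuc)
open import Data.Fin.Subset using (Subset; _─_; _∪_; ∣_∣)
open import Data.Product using (Σ; ∃; _×_)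
open import Data.Sum using (_⊎_)
open import Function.Definitions using (Injective)
open import Relation.Binary.PropositionalEquality using (_≡_)

Odd : ℕ → Set
Odd k = ∃ λ m → k ≡ 1 + 2 * m

-- Vertices of Q_n: subsets of {1,…,n}, i.e. Subset n.
-- Symmetric difference x Δ y = (x ∖ y) ∪ (y ∖ x).
_Δ_ : ∀ {n} → Subset n → Subset n → Subset n
x Δ y = (x ─ y) ∪ (y ─ x)

Adj : ∀ {n} → Subset n → Subset n → Set
Adj x y = ∣ x Δ y ∣ ≡ 1

-- P_k has vertices 0,…,k (Fin (suc k)) and edges {t, t+1} for t < k.
-- An embedding of P_k into Q_n: an injective vertex map sending edges to edges.
record PathEmbedding (k n : ℕ) : Set where
  field
    θ      : Fin (suc k) → Subset n
    inj    : Injective _≡_ _≡_ θ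
    edges  : ∀ (t : Fin k) → Adj (θ (inject₁ t)) (θ (fsuc t))

open PathEmbedding public

InImage : ∀ {k n} → PathEmbedding k n → Subset n → Subset n → Set
InImage {k} e u v = Σ (Fin k) λ t →
  (θ e (inject₁ t) ≡ u × θ e (fsuc t) ≡ v) ⊎ (θ e (inject₁ t) ≡ v × θ e (fsuc t) ≡ u)

Divides : ℕ → ℕ → Set
Divides k n = Σ ℕ λ r → Σ (Fin r → PathEmbedding k n) λ θs →
  ∀ (u v : Subset n) → Adj u v →
    Σ (Fin r) λ j → InImage (θs j) u v × (∀ (j′ : Fin r) → InImage (θs j′) u v → j′ ≡ j)

module Submission where

-- Proof by double counting DIRECTED edges (arcs).  An arc of Q_n is a pair
-- (u , i): leave vertex u by toggling coordinate i; there are 2^n · n of them.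
-- A decomposition θ_1,…,θ_r of E(Q_n) into copies of P_k has r · k · 2 arcs
-- (each of the k path edges traversed in either direction).  Sending an arc
-- of Q_n to the unique path arc covering it, and a path arc to the cube arc
-- it traverses, are mutually injective maps, so 2^n · n = r · (k · 2).  Hence
-- k ∣ 2^n · n, and since an odd k is coprime to 2, k ∣ n.

open import Defs
open import Data.Nat using (ℕ; _≤_)
open import Data.Nat.Divisibility using (_∣_)
open import Data.Nat using (zero; suc; _+_; _*_; _^_)
open import Data.Nat.Properties
  using (suc-injective; +-identityʳ; *-suc; *-assoc; ≤-antisym; ≤-trans; ≤-reflexive; n≤1+n; 1+n≰n)
open import Data.Nat.Divisibility using (∣n⇒∣m*n; m∣m*n)
open import Data.Nat.Coprimality using (Coprime; 1-coprimeTo; coprime-+; coprime-divisor)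
open import Data.Bool using (Bool; true; false; not)
open import Data.Fin using (Fin; inject₁; toℕ) renaming (zero to fzero; suc to fsuc)
open import Data.Fin.Properties
  using (2↔Bool; *↔×; injective⇒≤; toℕ-inject₁; inject₁-injective)
  renaming (suc-injective to fsuc-injective)
open import Data.Fin.Subset using (Subset; ∣_∣)
open import Data.Vec using ([]; _∷_; head; tail)
open import Data.Product using (Σ; _×_; _,_; proj₁; proj₂)
open import Data.Product.Function.NonDependent.Propositional using (_×-↔_)
open import Data.Sum using (inj₁; inj₂)
open import Data.Empty using (⊥; ⊥-elim)
open import Function using (_∘_)
open import Function.Bundles using (_↔_; Inverse; Injection; mk↔ₛ′)
open import Function.Construct.Composition using (_↔-∘_)
open import Function.Construct.Symmetry using (↔-sym)
open import Function.Construct.Identity using (↔-id)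
open import Function.Definitions using (Injective)
open import Function.Properties.Inverse using (Inverse⇒Injection)
open import Relation.Binary.PropositionalEquality
  using (_≡_; refl; sym; trans; cong; cong₂; subst; subst₂; module ≡-Reasoning)

HasSize : Set → ℕ → Set
HasSize A m = A ↔ Fin m

↔-injective : ∀ {A B : Set} (I : A ↔ B) → Injective _≡_ _≡_ (Inverse.to I)
↔-injective I = Injection.injective (Inverse⇒Injection I)

injection⇒size-≤ : ∀ {A B : Set} {a b : ℕ} → HasSize A a → HasSize B b →
                   (f : A → B) → Injective _≡_ _≡_ f → a ≤ b
injection⇒size-≤ A↔a B↔b f f-inj =
  injective⇒≤ {f = Inverse.to B↔b ∘ f ∘ Inverse.to (↔-sym A↔a)}
    (↔-injective (↔-sym A↔a) ∘ f-inj ∘ ↔-injective B↔b)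

mutual-injections⇒same-size : ∀ {A B : Set} {a b : ℕ} → HasSize A a → HasSize B b →
  (f : A → B) → Injective _≡_ _≡_ f → (g : B → A) → Injective _≡_ _≡_ g → a ≡ b
mutual-injections⇒same-size A↔a B↔b f f-inj g g-inj =
  ≤-antisym (injection⇒size-≤ A↔a B↔b f f-inj) (injection⇒size-≤ B↔b A↔a g g-inj)

×-size : ∀ {A B : Set} {a b : ℕ} → HasSize A a → HasSize B b → HasSize (A × B) (a * b)
×-size A↔a B↔b = ↔-sym *↔× ↔-∘ (A↔a ×-↔ B↔b)

Bool-size : HasSize Bool 2
Bool-size = ↔-sym 2↔Bool

Subset-size : ∀ n → HasSize (Subset n) (2 ^ n)
Subset-size zero = mk↔ₛ′ (λ _ → fzero) (λ _ → []) (λ { fzero → refl ; (fsuc ()) }) (λ { [] → refl })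
Subset-size (suc n) = ×-size Bool-size (Subset-size n) ↔-∘ uncons
  where
  uncons : Subset (suc n) ↔ (Bool × Subset n)
  uncons = mk↔ₛ′ (λ { (b ∷ u) → b , u }) (λ { (b , u) → b ∷ u })
                 (λ { (b , u) → refl }) (λ { (b ∷ u) → refl })

Fin-size : ∀ m → HasSize (Fin m) m
Fin-size m = ↔-id (Fin m)

toggle : ∀ {n} → Subset n → Fin n → Subset n
toggle (b ∷ u) fzero    = not b ∷ u
toggle (b ∷ u) (fsuc i) = b ∷ toggle u i

CubeArc : ℕ → Set
CubeArc n = Subset n × Fin n

CubeArc-size : ∀ n → HasSize (CubeArc n) (2 ^ n * n)
CubeArc-size n = ×-size (Subset-size n) (Fin-size n)

Δ-self : ∀ {n} (u : Subset n) → ∣ u Δ u ∣ ≡ 0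
Δ-self []          = refl
Δ-self (true ∷ u)  = Δ-self u
Δ-self (false ∷ u) = Δ-self u

Δ-empty⇒≡ : ∀ {n} (u v : Subset n) → ∣ u Δ v ∣ ≡ 0 → u ≡ v
Δ-empty⇒≡ []          []          _ = refl
Δ-empty⇒≡ (true ∷ u)  (true ∷ v)  d = cong (true ∷_) (Δ-empty⇒≡ u v d)
Δ-empty⇒≡ (false ∷ u) (false ∷ v) d = cong (false ∷_) (Δ-empty⇒≡ u v d)
Δ-empty⇒≡ (true ∷ u)  (false ∷ v) ()
Δ-empty⇒≡ (false ∷ u) (true ∷ v)  ()

Δ-comm : ∀ {n} (u v : Subset n) → u Δ v ≡ v Δ u
Δ-comm []          []          = refl
Δ-comm (true ∷ u)  (true ∷ v)  = cong (false ∷_) (Δ-comm u v)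
Δ-comm (false ∷ u) (false ∷ v) = cong (false ∷_) (Δ-comm u v)
Δ-comm (true ∷ u)  (false ∷ v) = cong (true ∷_) (Δ-comm u v)
Δ-comm (false ∷ u) (true ∷ v)  = cong (true ∷_) (Δ-comm u v)

Adj-sym : ∀ {n} {u v : Subset n} → Adj u v → Adj v u
Adj-sym {u = u} {v} uv = trans (cong ∣_∣ (Δ-comm v u)) uv

Adj-toggle : ∀ {n} (u : Subset n) (i : Fin n) → Adj u (toggle u i)
Adj-toggle (true ∷ u)  fzero    = cong suc (Δ-self u)
Adj-toggle (false ∷ u) fzero    = cong suc (Δ-self u)
Adj-toggle (true ∷ u)  (fsuc i) = Adj-toggle u i
Adj-toggle (false ∷ u) (fsuc i) = Adj-toggle u i

Adj⇒toggle : ∀ {n} (u v : Subset n) → Adj u v → Σ (Fin n) λ i → v ≡ toggle u i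
Adj⇒toggle [] [] ()
Adj⇒toggle (true ∷ u) (true ∷ v) uv =
  let (i , v≡) = Adj⇒toggle u v uv in fsuc i , cong (true ∷_) v≡
Adj⇒toggle (false ∷ u) (false ∷ v) uv =
  let (i , v≡) = Adj⇒toggle u v uv in fsuc i , cong (false ∷_) v≡
Adj⇒toggle (true ∷ u)  (false ∷ v) uv = fzero , cong (false ∷_) (sym (Δ-empty⇒≡ u v (suc-injective uv)))
Adj⇒toggle (false ∷ u) (true ∷ v)  uv = fzero , cong (true ∷_) (sym (Δ-empty⇒≡ u v (suc-injective uv)))

not-fixed : ∀ b → not b ≡ b → ⊥
not-fixed true  ()
not-fixed false ()

toggle-injective : ∀ {n} (u : Subset n) {i j : Fin n} → toggle u i ≡ toggle u j → i ≡ j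
toggle-injective (b ∷ u) {fzero}  {fzero}  _ = refl
toggle-injective (b ∷ u) {fzero}  {fsuc j} e = ⊥-elim (not-fixed b (cong head e))
toggle-injective (b ∷ u) {fsuc i} {fzero}  e = ⊥-elim (not-fixed b (sym (cong head e)))
toggle-injective (b ∷ u) {fsuc i} {fsuc j} e = cong fsuc (toggle-injective u (cong tail e))

-- Arcs of a path embedding: edge t of P_k traversed forwards (true) or
-- backwards (false).  A single copy of P_k has k · 2 arcs.
PathArc : ℕ → Set
PathArc k = Fin k × Bool

module _ {k n : ℕ} (e : PathEmbedding k n) where

  arc-tail arc-head : PathArc k → Subset n
  arc-tail (t , true)  = θ e (inject₁ t)
  arc-tail (t , false) = θ e (fsuc t)
  arc-head (t , true)  = θ e (fsuc t)
  arc-head (t , false) = θ e (inject₁ t)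

  arc-adj : ∀ a → Adj (arc-tail a) (arc-head a)
  arc-adj (t , true)  = edges e t
  arc-adj (t , false) = Adj-sym {u = θ e (inject₁ t)} (edges e t)

  arc-direction : ∀ a → Σ (Fin n) λ i → arc-head a ≡ toggle (arc-tail a) i
  arc-direction a = Adj⇒toggle (arc-tail a) (arc-head a) (arc-adj a)

  arc-in-image : ∀ a → InImage e (arc-tail a) (arc-head a)
  arc-in-image (t , true)  = t , inj₁ (refl , refl)
  arc-in-image (t , false) = t , inj₂ (refl , refl)

  image⇒arc : ∀ {u v} → InImage e u v → Σ (PathArc k) λ a → arc-tail a ≡ u × arc-head a ≡ v
  image⇒arc (t , inj₁ (u≡ , v≡)) = (t , true) , u≡ , v≡
  image⇒arc (t , inj₂ (v≡ , u≡)) = (t , false) , u≡ , v≡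

  -- An edge cannot be traversed backwards by a different edge: that would
  -- need t = t′ + 1 and t + 1 = t′ as vertex indices.
  no-swap : ∀ (t t′ : Fin k) → inject₁ t ≡ fsuc t′ → fsuc t ≡ inject₁ t′ → ⊥
  no-swap t t′ p q = 1+n≰n {toℕ t′}
    (≤-trans (≤-reflexive (trans (cong toℕ (sym p)) (toℕ-inject₁ t)))
             (≤-trans (n≤1+n (toℕ t)) (≤-reflexive (trans (cong toℕ q) (toℕ-inject₁ t′)))))

  -- Since θ is injective, an arc of the path is determined by its endpoints.
  arc-injective : ∀ a a′ → arc-tail a ≡ arc-tail a′ → arc-head a ≡ arc-head a′ → a ≡ a′
  arc-injective (t , true) (t′ , true) p _ with inject₁-injective (inj e p)
  ... | refl = refl
  arc-injective (t , false) (t′ , false) p _ with fsuc-injective (inj e p)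
  ... | refl = refl
  arc-injective (t , true)  (t′ , false) p q = ⊥-elim (no-swap t t′ (inj e p) (inj e q))
  arc-injective (t , false) (t′ , true)  p q = ⊥-elim (no-swap t′ t (inj e (sym p)) (inj e (sym q)))

module ArcCount {k n r : ℕ} (θs : Fin r → PathEmbedding k n)
  (partition : ∀ (u v : Subset n) → Adj u v →
    Σ (Fin r) λ j → InImage (θs j) u v × (∀ (j′ : Fin r) → InImage (θs j′) u v → j′ ≡ j))
  where

  DecompArc : Set
  DecompArc = Fin r × PathArc k

  DecompArc-size : HasSize DecompArc (r * (k * 2))
  DecompArc-size = ×-size (Fin-size r) (×-size (Fin-size k) Bool-size)

  tail′ head′ : DecompArc → Subset n
  tail′ (j , a) = arc-tail (θs j) a
  head′ (j , a) = arc-head (θs j) a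

  covering-arc : (x : CubeArc n) →
    Σ DecompArc λ d → tail′ d ≡ proj₁ x × head′ d ≡ toggle (proj₁ x) (proj₂ x)
  covering-arc (u , i) with partition u (toggle u i) (Adj-toggle u i)
  ... | j , in-θj , _ with image⇒arc (θs j) in-θj
  ...   | a , endpoints = (j , a) , endpoints

  cover : CubeArc n → DecompArc
  cover x = proj₁ (covering-arc x)

  cover-tail : ∀ x → tail′ (cover x) ≡ proj₁ x
  cover-tail x = proj₁ (proj₂ (covering-arc x))

  cover-head : ∀ x → head′ (cover x) ≡ toggle (proj₁ x) (proj₂ x)
  cover-head x = proj₂ (proj₂ (covering-arc x))

  cover-injective : Injective _≡_ _≡_ cover
  cover-injective {u , i} {u′ , i′} same
    with trans (sym (cover-tail (u , i))) (trans (cong tail′ same) (cover-tail (u′ , i′)))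
  ... | refl = cong (u ,_) (toggle-injective u
                 (trans (sym (cover-head (u , i))) (trans (cong head′ same) (cover-head (u , i′)))))

  -- Since each edge lies in exactly one path, endpoints determine a decomposition arc.
  endpoints-determine-arc : ∀ d d′ → tail′ d ≡ tail′ d′ → head′ d ≡ head′ d′ → d ≡ d′
  endpoints-determine-arc (j , a) (j′ , a′) tails heads
    with partition (tail′ (j , a)) (head′ (j , a)) (arc-adj (θs j) a)
  ... | _ , _ , unique
    with trans (unique j (arc-in-image (θs j) a))
               (sym (unique j′ (subst₂ (InImage (θs j′)) (sym tails) (sym heads) (arc-in-image (θs j′) a′))))
  ... | refl = cong (j ,_) (arc-injective (θs j) a a′ tails heads)

  traverse : DecompArc → CubeArc n
  traverse (j , a) = arc-tail (θs j) a , proj₁ (arc-direction (θs j) a)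

  traverse-injective : Injective _≡_ _≡_ traverse
  traverse-injective {j , a} {j′ , a′} same =
    endpoints-determine-arc (j , a) (j′ , a′) tails
      (begin
        arc-head (θs j) a                                      ≡⟨ proj₂ (arc-direction (θs j) a) ⟩
        toggle (arc-tail (θs j) a) (proj₁ (arc-direction (θs j) a))
                                                               ≡⟨ cong₂ toggle tails (cong proj₂ same) ⟩
        toggle (arc-tail (θs j′) a′) (proj₁ (arc-direction (θs j′) a′))
                                                               ≡⟨ sym (proj₂ (arc-direction (θs j′) a′)) ⟩
        arc-head (θs j′) a′                                    ∎)
    where
    open ≡-Reasoning
    tails = cong proj₁ same

  arc-count : 2 ^ n * n ≡ r * (k * 2)
  arc-count = mutual-injections⇒same-size (CubeArc-size n) DecompArc-size
                cover cover-injective traverse traverse-injective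

-- An odd number is coprime to 2: 1 is, and adding 2 preserves coprimality to 2.
odd⇒coprime-2 : ∀ {k} → Odd k → Coprime k 2
odd⇒coprime-2 (zero , refl)  = 1-coprimeTo 2
odd⇒coprime-2 (suc m , refl) =
  subst (λ x → Coprime x 2) (sym (cong (1 +_) (*-suc 2 m))) (coprime-+ (odd⇒coprime-2 (m , refl)))

odd∣2^m*n⇒∣n : ∀ {k} m n → Odd k → k ∣ 2 ^ m * n → k ∣ n
odd∣2^m*n⇒∣n {k} zero    n _   k∣ = subst (k ∣_) (+-identityʳ n) k∣
odd∣2^m*n⇒∣n {k} (suc m) n odd k∣ =
  odd∣2^m*n⇒∣n m n odd (coprime-divisor (odd⇒coprime-2 odd) (subst (k ∣_) (*-assoc 2 (2 ^ m) n) k∣))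

proposition3 : ∀ (k n : ℕ) → 1 ≤ k → 1 ≤ n → Odd k → Divides k n → k ∣ n
proposition3 k n _ _ odd (r , θs , partition) = odd∣2^m*n⇒∣n n n odd k∣2^n*n
  where
  k∣2^n*n : k ∣ 2 ^ n * n
  k∣2^n*n = subst (k ∣_) (sym (ArcCount.arc-count θs partition)) (∣n⇒∣m*n r (m∣m*n 2))
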